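{- Let $f:\{0,1\}^m\to\{0,1\}$, $n\in\mathbb{N}$, and let $\Pi$ be a partially half-duplex protocol that solves $\mathit{KW}_f\circledast\mathit{MUX}_n$. For every transcript $\pi_1$ of $\Pi$ such that $\mathcal{V}_{\pi_1}\neq\emptyset$, the complexity of $\Pi$ is at least \[ |\pi_1|+\log\log\chi(\mathcal{G}_{\pi_1})-\log\log\log\chi(\mathcal{G}_{\pi_1})-4. \]
   Context: Logs base 2; $\chi$ denotes chromatic number. For $g:\{0,1\}^n\to\{0,1\}$ and $X\in\{0,1\}^{m\times n}$ with rows $X_i$, $g(X)\in\{0,1\}^m$ applies $g$ to each row and $(f\diamond g)(X)=f(g(X))$. $\mathit{KW}_f\circledast\mathit{MUX}_n$: Alice gets $g_A:\{0,1\}^n\to\{0,1\}$ and $X\in\{0,1\}^{m\times n}$ with $(f\diamond g_A)(X)=1$; Bob gets $g_B$ and $Y$ with $(f\diamond g_B)(Y)=0$; with $a=g_A(X)$, $b=g_B(Y)$ they must output $(i,j)$ with $a_i\neq b_i$ and $X_{i,j}\neq Y_{i,j}$, or may output $\bot$ if $g_A\neq g_B$. Half-duplex protocol: a pair of full 4-ary trees $\Pi_A,\Pi_B$ of equal depth (the complexity of $\Pi$). Each vertex $u$ of $\Pi_A$ is labeled by a set $\mathcal{X}_u$ of Alice inputs (root: all inputs); the children of internal $u$ are $u_{\mathrm{rcv}(0)},u_{\mathrm{rcv}(1)},u_{\mathrm{send}(0)},u_{\mathrm{send}(1)}$ with $\mathcal{X}_{u_{\mathrm{rcv}(0)}}=\mathcal{X}_{u_{\mathrm{rcv}(1)}}$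 and $\mathcal{X}_u$ the disjoint union of $\mathcal{X}_{u_{\mathrm{rcv}(0)}},\mathcal{X}_{u_{\mathrm{send}(0)}},\mathcal{X}_{u_{\mathrm{send}(1)}}$; similarly $\Pi_B$. Leaves carry outputs. Execution from the roots: if one player's input is in a $\mathrm{send}(\sigma)$ set and the other's in the receive set, they move to $\mathrm{send}(\sigma)$ / $\mathrm{rcv}(\sigma)$ (classical round); if both send $\sigma,\tau$ they move to $\mathrm{send}(\sigma),\mathrm{send}(\tau)$ (wasted); if both receive they move to $\mathrm{rcv}(\sigma),\mathrm{rcv}(\tau)$ for adversarial bits (silent). Both must reach leaves at the same round with the same output; $\Pi$ solves the problem if all possible outputs are valid. $\Pi$ is partially half-duplex if whenever $g_A=g_B$ all rounds of every execution are classical. For $\pi\in\{0,1\}^*$: a vertex of $\Pi_A$ at depth $|\pi|$ is consistent with $\pi$ if the $i$-th edge on its root path is labeled $\mathrm{rcv}(\pi_i)$ or $\mathrm{send}(\pi_i)$; an Alice input is consistent with $\pi$ if it lies in $\mathcal{X}_u$ for such $u$; similarly for Bob. $\mathcal{X}_\pi,\mathcal{Y}_\pi$ are the consistent input sets; $\pi$ is a transcript if both are non-empty. $\mathcal{X}_\pi(g)=\{X:(g,X)\in\mathcal{X}_\pi\}$, $\mathcal{Y}_\pi(g)=\{Y:(g,Y)\in\mathcal{Y}_\pi\}$; $\mathcal{A}_\pi(g)$ ($\mathcal{B}_\pi(g)$) is the set of $a\in f^{ -1}(1)$ ($b\in f^{ -1}(0)$) such that some $X\in\mathcal{X}_\pi(g)$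 has $g(X)=a$ (some $Y\in\mathcal{Y}_\pi(g)$ has $g(Y)=b$); $\mathcal{V}_\pi$ is the set of $g$ for which both are non-empty. The characteristic graph $\mathcal{G}_{\pi_1}$ has vertex set $\mathcal{V}_{\pi_1}$, and distinct $g_A,g_B$ are adjacent iff (weak intersection property) there exist $X\in\mathcal{X}_{\pi_1}(g_A)$ and $Y\in\mathcal{Y}_{\pi_1}(g_B)$ such that $X_i=Y_i$ for every $i\in[m]$ with $a_i\neq b_i$, where $a=g_A(X)$, $b=g_B(Y)$, or the same holds with $g_A$ and $g_B$ exchanged. -}

module Defs where

open import Data.Nat using (ℕ; zero; suc; _+_; _*_; _^_; _≤_; _<_)
open import Data.Bool using (Bool; true; false)
open import Data.Fin using (Fin)
open import Data.Vec using (Vec; map; lookup)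
open import Data.List using (List; []; _∷_; length)
open import Data.Maybe using (Maybe; just; nothing)
open import Data.Product using (Σ; Σ-syntax; ∃; ∃-syntax; _×_; _,_)
open import Data.Sum using (_⊎_)
open import Data.Unit using (⊤)
open import Data.Empty using (⊥)
open import Relation.Nullary using (¬_)
open import Relation.Binary.PropositionalEquality using (_≡_; _≢_)

-- Full 4-ary protocol trees (one player's side).
-- A node stores the input sets labelling its children:
--   Lr  : the common set of the children rcv(0), rcv(1)
--   L0  : the set of the child send(0)
--   L1  : the set of the child send(1)
-- and the four subtrees (rcv(0), rcv(1), send(0), send(1)).

data PTree (I O : Set) : ℕ → Set₁ where
  leaf : O → PTree I O zero
  node : {d : ℕ} → (Lr L0 L1 : I → Set) →
         (tr0 tr1 ts0 ts1 : PTree I O d) → PTree I O (suc d)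

data WF {I O : Set} : (I → Set) → {d : ℕ} → PTree I O d → Set₁ where
  wf-leaf : ∀ {S o} → WF S (leaf o)
  wf-node : ∀ {S d Lr L0 L1} {tr0 tr1 ts0 ts1 : PTree I O d} →
    (∀ x → S x → Lr x ⊎ (L0 x ⊎ L1 x)) →
    (∀ x → Lr x → S x) → (∀ x → L0 x → S x) → (∀ x → L1 x → S x) →
    (∀ x → Lr x → L0 x → ⊥) → (∀ x → Lr x → L1 x → ⊥) →
    (∀ x → L0 x → L1 x → ⊥) →
    WF Lr tr0 → WF Lr tr1 → WF L0 ts0 → WF L1 ts1 →
    WF S (node Lr L0 L1 tr0 tr1 ts0 ts1)

rcvSet : ∀ {I O d} → PTree I O (suc d) → I → Set
rcvSet (node Lr _ _ _ _ _ _) = Lr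

sendSet : ∀ {I O d} → Bool → PTree I O (suc d) → I → Set
sendSet false (node _ L0 _ _ _ _ _) = L0
sendSet true  (node _ _ L1 _ _ _ _) = L1

rcvChild : ∀ {I O d} → Bool → PTree I O (suc d) → PTree I O d
rcvChild false (node _ _ _ t _ _ _) = t
rcvChild true  (node _ _ _ _ t _ _) = t

sendChild : ∀ {I O d} → Bool → PTree I O (suc d) → PTree I O d
sendChild false (node _ _ _ _ _ t _) = t
sendChild true  (node _ _ _ _ _ _ t) = t

-- Possible executions of a pair of trees on inputs x, y, ending in
-- leaves with outputs oA, oB.  The Bool index is true iff every round of
-- the execution is classical.
data Run {I J O : Set} (x : I) (y : J) :
     {d : ℕ} → PTree I O d → PTree J O d → O → O → Bool → Set₁ where
  run-leaf : ∀ {oA oB} → Run x y (leaf oA) (leaf oB) oA oB true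
  run-AB : ∀ {d} {tA : PTree I O (suc d)} {tB : PTree J O (suc d)}
    {oA oB c} (σ : Bool) →
    sendSet σ tA x → rcvSet tB y →
    Run x y (sendChild σ tA) (rcvChild σ tB) oA oB c →
    Run x y tA tB oA oB c
  run-BA : ∀ {d} {tA : PTree I O (suc d)} {tB : PTree J O (suc d)}
    {oA oB c} (σ : Bool) →
    rcvSet tA x → sendSet σ tB y →
    Run x y (rcvChild σ tA) (sendChild σ tB) oA oB c →
    Run x y tA tB oA oB c
  run-wasted : ∀ {d} {tA : PTree I O (suc d)} {tB : PTree J O (suc d)}
    {oA oB c} (σ τ : Bool) →
    sendSet σ tA x → sendSet τ tB y →
    Run x y (sendChild σ tA) (sendChild τ tB) oA oB c →
    Run x y tA tB oA oB false
  -- silent: both receive, adversarial bits σ, τ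
  run-silent : ∀ {d} {tA : PTree I O (suc d)} {tB : PTree J O (suc d)}
    {oA oB c} (σ τ : Bool) →
    rcvSet tA x → rcvSet tB y →
    Run x y (rcvChild σ tA) (rcvChild τ tB) oA oB c →
    Run x y tA tB oA oB false

Cons : ∀ {I O d} → (I → Set) → PTree I O d → List Bool → I → Set
Cons S t [] x = S x
Cons S (leaf _) (_ ∷ _) x = ⊥
Cons S (node Lr L0 L1 tr0 tr1 ts0 ts1) (false ∷ π) x =
  Cons Lr tr0 π x ⊎ Cons L0 ts0 π x
Cons S (node Lr L0 L1 tr0 tr1 ts0 ts1) (true ∷ π) x =
  Cons Lr tr1 π x ⊎ Cons L1 ts1 π x

Colorable : {V : Set} (Vert : V → Set) (Adj : V → V → Set) → ℕ → Set
Colorable {V} Vert Adj k =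
  Σ[ c ∈ ((v : V) → Vert v → Fin k) ]
    (∀ u v (pu : Vert u) (pv : Vert v) → Adj u v → c u pu ≢ c v pv)

IsChromaticNumber : {V : Set} (Vert : V → Set) (Adj : V → V → Set) → ℕ → Set
IsChromaticNumber Vert Adj k =
  Colorable Vert Adj k × (∀ j → Colorable Vert Adj j → k ≤ j)

-- The real inequality  c ≥ ℓ + log log χ − log log log χ − 4  (logs base 2,
-- for χ ≥ 3 so that every term is a real number), expressed over ℕ.
-- With L = log χ, P = 2^ℓ, Q = 2^(c+4) it is equivalent to L ≥ χ^(P/Q),
-- i.e. every rational a/b ≥ 0 with (a/b)^Q < χ^P satisfies 2^(a/b) ≤ χ.
LogBound : (c ℓ χ : ℕ) → Set
LogBound c ℓ χ =
  ∀ (a b : ℕ) → 1 ≤ b →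
    a ^ (2 ^ (c + 4)) < χ ^ (2 ^ ℓ) * b ^ (2 ^ (c + 4)) →
    2 ^ a ≤ χ ^ b

module KWMux (m n : ℕ) (f : Vec Bool m → Bool) where

  Fn : Set
  Fn = Vec Bool n → Bool

  Mat : Set
  Mat = Vec (Vec Bool n) m

  app : Fn → Mat → Vec Bool m
  app g X = map g X

  SameFn : Fn → Fn → Set
  SameFn g h = ∀ x → g x ≡ h x

  InA : Set
  InA = Σ[ g ∈ Fn ] Σ[ X ∈ Mat ] f (app g X) ≡ true

  InB : Set
  InB = Σ[ g ∈ Fn ] Σ[ Y ∈ Mat ] f (app g Y) ≡ false

  -- outputs: (i , j) or ⊥ (= nothing)
  Out : Set
  Out = Maybe (Fin m × Fin n)

  Valid : InA → InB → Out → Set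
  Valid (gA , X , _) (gB , Y , _) (just (i , j)) =
    lookup (app gA X) i ≢ lookup (app gB Y) i ×
    lookup (lookup X i) j ≢ lookup (lookup Y i) j
  Valid (gA , X , _) (gB , Y , _) nothing = ¬ SameFn gA gB

  record Protocol : Set₁ where
    field
      depth : ℕ        -- the complexity of Π
      ΠA : PTree InA Out depth
      ΠB : PTree InB Out depth
      wfA : WF (λ _ → ⊤) ΠA
      wfB : WF (λ _ → ⊤) ΠB

  open Protocol public

  Solves : Protocol → Set₁
  Solves Π = ∀ (x : InA) (y : InB) oA oB c →
    Run x y (ΠA Π) (ΠB Π) oA oB c → (oA ≡ oB) × Valid x y oA

  PartiallyHalfDuplex : Protocol → Set₁
  PartiallyHalfDuplex Π = ∀ (x : InA) (y : InB) →
    SameFn (Data.Product.proj₁ x) (Data.Product.proj₁ y) →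
    ∀ oA oB c → Run x y (ΠA Π) (ΠB Π) oA oB c → c ≡ true

  module _ (Π : Protocol) where

    ConsA : List Bool → InA → Set
    ConsA π = Cons (λ _ → ⊤) (ΠA Π) π

    ConsB : List Bool → InB → Set
    ConsB π = Cons (λ _ → ⊤) (ΠB Π) π

    IsTranscript : List Bool → Set
    IsTranscript π = (∃ λ x → ConsA π x) × (∃ λ y → ConsB π y)

    Xπ : List Bool → Fn → Mat → Set
    Xπ π g X = Σ[ p ∈ f (app g X) ≡ true ] ConsA π (g , X , p)

    Yπ : List Bool → Fn → Mat → Set
    Yπ π g Y = Σ[ p ∈ f (app g Y) ≡ false ] ConsB π (g , Y , p)

    𝒜π : List Bool → Fn → Vec Bool m → Set
    𝒜π π g a = (f a ≡ true) × (∃ λ X → Xπ π g X × app g X ≡ a)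

    ℬπ : List Bool → Fn → Vec Bool m → Set
    ℬπ π g b = (f b ≡ false) × (∃ λ Y → Yπ π g Y × app g Y ≡ b)

    𝒱π : List Bool → Fn → Set
    𝒱π π g = (∃ λ a → 𝒜π π g a) × (∃ λ b → ℬπ π g b)

    WeakInt : List Bool → Fn → Fn → Set
    WeakInt π gA gB = Σ[ X ∈ Mat ] Σ[ Y ∈ Mat ]
      Xπ π gA X × Yπ π gB Y ×
      (∀ i → lookup (app gA X) i ≢ lookup (app gB Y) i →
             lookup X i ≡ lookup Y i)

    Adjπ : List Bool → Fn → Fn → Set
    Adjπ π gA gB = ¬ SameFn gA gB × (WeakInt π gA gB ⊎ WeakInt π gB gA)

{-# OPTIONS --safe #-}
module Submission where

-- Colour each g ∈ 𝒱_{π₁} by a binary tree of bits indexed by the continuations ρ of π₁: at an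
-- internal position, whether some Alice input (g, X) consistent with ρ sends there; at a leaf
-- (|ρ| = depth), whether some Bob input (g, Y) is consistent with ρ.  Suppose adjacent g₁, g₂, with
-- weak-intersection witnesses x = (g₁, X) and y = (g₂, Y), got the same colour, and follow from π₁
-- a bit consistent with both.  If both ever send, the equal sender bits give a sending Alice input
-- (g₂, X₀), and (g₂, X₀) against y has a wasted round although g_A = g_B.  Otherwise, at a leaf
-- the equal leaf bits give a Bob input (g₁, Y′) on the same transcript, so Alice's output is valid
-- both against y and against (g₁, Y′); but ⊥ is invalid for equal functions, and (i, j) is invalid
-- against y because X and Y agree on the rows where g₁(X) and g₂(Y) differ.  With
-- e = depth − |π₁| there are at most 2^(2^(e+1) − 1) colours, so log log χ ≤ depth − |π₁| + 1,
-- which is stronger than the claimed bound.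

open import Defs
open import Data.Nat using (ℕ; zero; suc; _+_; _*_; _^_; _∸_; _≤_; _<_; z≤n; s≤s; z<s; NonZero)
open import Data.Nat.Properties
  using ( m<n⇒0<n∸m; n∸n≡0; m+[n∸m]≡n; m≤m+n; m<m+n; m≤n*m
        ; ≤-refl; ≤-reflexive; <⇒≤; <-≤-trans; ≰⇒>; ≮⇒≥; <⇒≱
        ; +-comm; +-assoc; +-identityʳ; *-comm; *-assoc; [m*n]*[o*p]≡[m*o]*[n*p]
        ; *-mono-≤; *-monoˡ-≤; *-monoʳ-<
        ; ^-distribˡ-+-*; ^-*-assoc; ^-monoˡ-≤; ^-monoʳ-≤; ^-monoˡ-<; module ≤-Reasoning)
open import Data.Bool using (Bool; true; false; _∧_; T)
open import Data.Bool.Properties using (∧-zeroʳ) renaming (_≟_ to _≟ᵇ_)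
open import Data.Fin using (Fin)
open import Data.Fin.Properties using (2↔Bool; *↔×)
open import Data.Vec using (Vec; []; _∷_; lookup)
open import Data.List using (List; []; _∷_; length; _++_; [_])
open import Data.List.Properties using (length-++)
open import Data.Maybe using (just; nothing)
open import Data.Product using (Σ; ∃; ∃₂; _×_; _,_; proj₁; proj₂)
open import Data.Product.Function.NonDependent.Propositional using (_×-↣_)
open import Data.Sum using (_⊎_; inj₁; inj₂; [_,_]′)
open import Data.Unit using (⊤; tt)
open import Data.Empty using (⊥; ⊥-elim)
open import Function using (id; _∘_)
open import Function.Bundles using (_↣_; Injection)
open import Function.Construct.Composition using (_↣-∘_)
open import Function.Construct.Symmetry using (↔-sym)
open import Function.Properties.Inverse using (↔⇒↣)
open import Axiom.UniquenessOfIdentityProofs using (module Decidable⇒UIP)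
open import Relation.Nullary using (¬_; Dec; yes; no)
open import Relation.Nullary.Decidable using (map′; _×-dec_; _⊎-dec_; ¬?; isYes; toWitness; fromWitness)
open import Relation.Unary using (Decidable)
open import Relation.Binary.PropositionalEquality using (_≡_; _≢_; refl; sym; trans; cong; subst)

Searchable : Set → Set₁
Searchable A = ∀ {P : A → Set} → Decidable P → Dec (∃ P)

Bool-searchable : Searchable Bool
Bool-searchable P? =
  map′ [ (false ,_) , (true ,_) ]′ (λ { (false , p) → inj₁ p ; (true , p) → inj₂ p })
       (P? false ⊎-dec P? true)

Vec-searchable : ∀ {A} → Searchable A → ∀ k → Searchable (Vec A k)
Vec-searchable _ zero P? = map′ ([] ,_) (λ { ([] , p) → p }) (P? [])
Vec-searchable search (suc k) P? =
  map′ (λ (a , v , p) → a ∷ v , p) (λ { (a ∷ v , p) → a , v , p })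
       (search λ a → Vec-searchable search k (P? ∘ (a ∷_)))

Σ-≡? : ∀ (b c : Bool) {Q : b ≡ c → Set} → (∀ p → Dec (Q p)) → Dec (Σ (b ≡ c) Q)
Σ-≡? b c {Q} Q? with b ≟ᵇ c
... | no b≢c = no (b≢c ∘ proj₁)
... | yes p  = map′ (p ,_) (λ (p′ , q) → subst Q (≡-irrelevant p′ p) q) (Q? p)
  where open Decidable⇒UIP _≟ᵇ_

isYes-transfer : ∀ {P Q : Set} (P? : Dec P) (Q? : Dec Q) → isYes P? ≡ isYes Q? → P → Q
isYes-transfer P? Q? same p = toWitness {a? = Q?} (subst T same (fromWitness {a? = P?} p))

module _ {I O : Set} where

  Receiver : ∀ {d} → PTree I O d → I → Set
  Receiver (leaf _) _ = ⊥
  Receiver t@(node _ _ _ _ _ _ _) = rcvSet t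

  Sender : ∀ {d} → Bool → PTree I O d → I → Set
  Sender _ (leaf _) _ = ⊥
  Sender σ t@(node _ _ _ _ _ _ _) = sendSet σ t

  role : ∀ {d S} {t : PTree I O d} {x} → WF S t → S x → 0 < d →
         Receiver t x ⊎ ∃ λ σ → Sender σ t x
  role (wf-node cover _ _ _ _ _ _ _ _ _ _) sx _ with cover _ sx
  ... | inj₁ r        = inj₁ r
  ... | inj₂ (inj₁ l) = inj₂ (false , l)
  ... | inj₂ (inj₂ l) = inj₂ (true , l)

  WF-rcvChild : ∀ {d S} {t : PTree I O (suc d)} b → WF S t → WF (rcvSet t) (rcvChild b t)
  WF-rcvChild false (wf-node _ _ _ _ _ _ _ w _ _ _) = w
  WF-rcvChild true  (wf-node _ _ _ _ _ _ _ _ w _ _) = w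

  WF-sendChild : ∀ {d S} {t : PTree I O (suc d)} b → WF S t → WF (sendSet b t) (sendChild b t)
  WF-sendChild false (wf-node _ _ _ _ _ _ _ _ _ w _) = w
  WF-sendChild true  (wf-node _ _ _ _ _ _ _ _ _ _ w) = w

  Cons⇒label : ∀ {d S} {t : PTree I O d} {x} ρ → WF S t → Cons S t ρ x → S x
  Cons⇒label []          _ sx = sx
  Cons⇒label (_ ∷ _)     wf-leaf ()
  Cons⇒label (false ∷ ρ) (wf-node _ r⊆ _ _ _ _ _ w _ _ _) (inj₁ c) = r⊆ _ (Cons⇒label ρ w c)
  Cons⇒label (false ∷ ρ) (wf-node _ _ 0⊆ _ _ _ _ _ _ w _) (inj₂ c) = 0⊆ _ (Cons⇒label ρ w c)
  Cons⇒label (true ∷ ρ)  (wf-node _ r⊆ _ _ _ _ _ _ w _ _) (inj₁ c) = r⊆ _ (Cons⇒label ρ w c)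
  Cons⇒label (true ∷ ρ)  (wf-node _ _ _ 1⊆ _ _ _ _ _ _ w) (inj₂ c) = 1⊆ _ (Cons⇒label ρ w c)

  Cons? : ∀ {d S} {t : PTree I O d} {x} → WF S t → S x → ∀ ρ → Dec (Cons S t ρ x)
  Cons? _ sx [] = yes sx
  Cons? wf-leaf _ (_ ∷ _) = no λ ()
  Cons? (wf-node cover _ _ _ r∩0 r∩1 0∩1 wr0 wr1 ws0 ws1) sx (false ∷ ρ) with cover _ sx
  ... | inj₁ r =
    map′ inj₁ [ id , (λ c → ⊥-elim (r∩0 _ r (Cons⇒label ρ ws0 c))) ]′ (Cons? wr0 r ρ)
  ... | inj₂ (inj₁ l) =
    map′ inj₂ [ (λ c → ⊥-elim (r∩0 _ (Cons⇒label ρ wr0 c) l)) , id ]′ (Cons? ws0 l ρ)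
  ... | inj₂ (inj₂ l) =
    no [ (λ c → r∩1 _ (Cons⇒label ρ wr0 c) l) , (λ c → 0∩1 _ (Cons⇒label ρ ws0 c) l) ]′
  Cons? (wf-node cover _ _ _ r∩0 r∩1 0∩1 wr0 wr1 ws0 ws1) sx (true ∷ ρ) with cover _ sx
  ... | inj₁ r =
    map′ inj₁ [ id , (λ c → ⊥-elim (r∩1 _ r (Cons⇒label ρ ws1 c))) ]′ (Cons? wr1 r ρ)
  ... | inj₂ (inj₁ l) =
    no [ (λ c → r∩0 _ (Cons⇒label ρ wr1 c) l) , (λ c → 0∩1 _ l (Cons⇒label ρ ws1 c)) ]′
  ... | inj₂ (inj₂ l) =
    map′ inj₂ [ (λ c → ⊥-elim (r∩1 _ (Cons⇒label ρ wr1 c) l)) , id ]′ (Cons? ws1 l ρ)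

  -- The endpoint is indexed by d ∸ |ρ| so that paths along the same ρ in Alice's and Bob's
  -- trees end at vertices of equal depth.
  data Path (x : I) : ∀ {d} → (I → Set) → PTree I O d → (ρ : List Bool) →
                      (I → Set) → PTree I O (d ∸ length ρ) → Set₁ where
    []    : ∀ {d S} {t : PTree I O d} → Path x S t [] S t
    rcv∷  : ∀ {d S S′ ρ} {t : PTree I O (suc d)} {t′} b → rcvSet t x →
            Path x (rcvSet t) (rcvChild b t) ρ S′ t′ → Path x S t (b ∷ ρ) S′ t′
    send∷ : ∀ {d S S′ ρ} {t : PTree I O (suc d)} {t′} b → sendSet b t x →
            Path x (sendSet b t) (sendChild b t) ρ S′ t′ → Path x S t (b ∷ ρ) S′ t′

  record Reached (x : I) {d} (S : I → Set) (t : PTree I O d) (ρ : List Bool) : Set₁ where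
    constructor reached
    field
      {label}  : I → Set
      {vertex} : PTree I O (d ∸ length ρ)
      path     : Path x S t ρ label vertex
      member   : label x
      wf       : WF label vertex

  reach-rcv : ∀ {d S ρ x} {t : PTree I O (suc d)} b → rcvSet t x →
              Reached x (rcvSet t) (rcvChild b t) ρ → Reached x S t (b ∷ ρ)
  reach-rcv b r (reached p m w) = reached (rcv∷ b r p) m w

  reach-send : ∀ {d S ρ x} {t : PTree I O (suc d)} b → sendSet b t x →
               Reached x (sendSet b t) (sendChild b t) ρ → Reached x S t (b ∷ ρ)
  reach-send b l (reached p m w) = reached (send∷ b l p) m w

  reach : ∀ {d S} {t : PTree I O d} {x} ρ → WF S t → Cons S t ρ x → Reached x S t ρ
  reach []          w  sx = reached [] sx w
  reach (_ ∷ _)     wf-leaf ()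
  reach (false ∷ ρ) (wf-node _ _ _ _ _ _ _ w _ _ _) (inj₁ c) =
    reach-rcv false (Cons⇒label ρ w c) (reach ρ w c)
  reach (false ∷ ρ) (wf-node _ _ _ _ _ _ _ _ _ w _) (inj₂ c) =
    reach-send false (Cons⇒label ρ w c) (reach ρ w c)
  reach (true ∷ ρ)  (wf-node _ _ _ _ _ _ _ _ w _ _) (inj₁ c) =
    reach-rcv true (Cons⇒label ρ w c) (reach ρ w c)
  reach (true ∷ ρ)  (wf-node _ _ _ _ _ _ _ _ _ _ w) (inj₂ c) =
    reach-send true (Cons⇒label ρ w c) (reach ρ w c)

  Path-++ : ∀ {d S S′ x ρ} {t : PTree I O d} {t′} σ →
            Path x S t ρ S′ t′ → Cons S′ t′ σ x → Cons S t (ρ ++ σ) x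
  Path-++ σ [] c = c
  Path-++ {t = node _ _ _ _ _ _ _} σ (rcv∷ false _ p) c = inj₁ (Path-++ σ p c)
  Path-++ {t = node _ _ _ _ _ _ _} σ (rcv∷ true _ p) c = inj₁ (Path-++ σ p c)
  Path-++ {t = node _ _ _ _ _ _ _} σ (send∷ false _ p) c = inj₂ (Path-++ σ p c)
  Path-++ {t = node _ _ _ _ _ _ _} σ (send∷ true _ p) c = inj₂ (Path-++ σ p c)

  Path⇒length≤ : ∀ {d S S′ x ρ} {t : PTree I O d} {t′} → Path x S t ρ S′ t′ → length ρ ≤ d
  Path⇒length≤ [] = z≤n
  Path⇒length≤ (rcv∷ _ _ p) = s≤s (Path⇒length≤ p)
  Path⇒length≤ (send∷ _ _ p) = s≤s (Path⇒length≤ p)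

  Receiver⇒Cons : ∀ {d S} {t : PTree I O d} {x} b → Receiver t x → Cons S t [ b ] x
  Receiver⇒Cons {t = node _ _ _ _ _ _ _} false r = inj₁ r
  Receiver⇒Cons {t = node _ _ _ _ _ _ _} true  r = inj₁ r

  Sender⇒Cons : ∀ {d S} {t : PTree I O d} {x} σ → Sender σ t x → Cons S t [ σ ] x
  Sender⇒Cons {t = node _ _ _ _ _ _ _} false l = inj₂ l
  Sender⇒Cons {t = node _ _ _ _ _ _ _} true  l = inj₂ l

  Receives : ∀ {d} → (I → Set) → PTree I O d → List Bool → I → Set
  Receives S t ρ x = ∀ b → Cons S t (ρ ++ [ b ]) x

  -- Only meaningful for |ρ| < d: at full depth every consistent input "sends".
  Sends : ∀ {d} → (I → Set) → PTree I O d → List Bool → I → Set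
  Sends S t ρ x = Cons S t ρ x × ¬ Receives S t ρ x

  Receives? : ∀ {d S} {t : PTree I O d} {x} → WF S t → S x → ∀ ρ → Dec (Receives S t ρ x)
  Receives? w sx ρ =
    map′ (λ (c₀ , c₁) → λ { false → c₀ ; true → c₁ }) (λ r → r false , r true)
         (Cons? w sx (ρ ++ [ false ]) ×-dec Cons? w sx (ρ ++ [ true ]))

  Sends? : ∀ {d S} {t : PTree I O d} {x} → WF S t → S x → ∀ ρ → Dec (Sends S t ρ x)
  Sends? w sx ρ = Cons? w sx ρ ×-dec ¬? (Receives? w sx ρ)

  receives-or-reaches-sender : ∀ {d S} {t : PTree I O d} {x} ρ →
    WF S t → Cons S t ρ x → length ρ < d →
    Receives S t ρ x ⊎ Σ (Reached x S t ρ) λ r → ∃ λ σ → Sender σ (Reached.vertex r) x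
  receives-or-reaches-sender ρ w c ρ<d with reach ρ w c
  ... | r@(reached {S′} {t′} p sx w′) with role w′ sx (m<n⇒0<n∸m ρ<d)
  ...   | inj₁ rcv = inj₁ λ b → Path-++ [ b ] p (Receiver⇒Cons {S = S′} {t′} b rcv)
  ...   | inj₂ snd = inj₂ (r , snd)

  Cons-extend : ∀ {d S} {t : PTree I O d} {x} ρ → WF S t → Cons S t ρ x → length ρ < d →
                ∃ λ b → Cons S t (ρ ++ [ b ]) x
  Cons-extend ρ w c ρ<d with receives-or-reaches-sender ρ w c ρ<d
  ... | inj₁ rcv = false , rcv false
  ... | inj₂ (reached {S′} {t′} p _ _ , σ , l) =
    σ , Path-++ [ σ ] p (Sender⇒Cons {S = S′} {t′} σ l)

module _ {I J O : Set} where

  run-along : ∀ {x y d ρ SA SA′ SB SB′ oA oB c} {tA : PTree I O d} {tB : PTree J O d} {tA′ tB′} →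
    Path x SA tA ρ SA′ tA′ → Path y SB tB ρ SB′ tB′ → Run x y tA′ tB′ oA oB c →
    ∃ λ b → Run x y tA tB oA oB (b ∧ c)
  run-along [] [] r = true , r
  run-along (rcv∷ b rx p) (rcv∷ .b ry q) r = false , run-silent b b rx ry (proj₂ (run-along p q r))
  run-along (rcv∷ b rx p) (send∷ .b ly q) r = let b′ , r′ = run-along p q r in b′ , run-BA b rx ly r′
  run-along (send∷ b lx p) (rcv∷ .b ry q) r = let b′ , r′ = run-along p q r in b′ , run-AB b lx ry r′
  run-along (send∷ b lx p) (send∷ .b ly q) r = false , run-wasted b b lx ly (proj₂ (run-along p q r))

  some-run : ∀ {x y d SA SB} {tA : PTree I O d} {tB : PTree J O d} →
    WF SA tA → SA x → WF SB tB → SB y → ∃₂ λ oA oB → ∃ (Run x y tA tB oA oB)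
  some-run wf-leaf _ wf-leaf _ = _ , _ , _ , run-leaf
  some-run wA@(wf-node _ _ _ _ _ _ _ _ _ _ _) sx wB@(wf-node _ _ _ _ _ _ _ _ _ _ _) sy
    with role wA sx z<s | role wB sy z<s
  ... | inj₁ rx | inj₁ ry =
    let oA , oB , _ , r = some-run (WF-rcvChild false wA) rx (WF-rcvChild false wB) ry
    in oA , oB , false , run-silent false false rx ry r
  ... | inj₁ rx | inj₂ (τ , ly) =
    let oA , oB , c , r = some-run (WF-rcvChild τ wA) rx (WF-sendChild τ wB) ly
    in oA , oB , c , run-BA τ rx ly r
  ... | inj₂ (σ , lx) | inj₁ ry =
    let oA , oB , c , r = some-run (WF-sendChild σ wA) lx (WF-rcvChild σ wB) ry
    in oA , oB , c , run-AB σ lx ry r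
  ... | inj₂ (σ , lx) | inj₂ (τ , ly) =
    let oA , oB , _ , r = some-run (WF-sendChild σ wA) lx (WF-sendChild τ wB) ly
    in oA , oB , false , run-wasted σ τ lx ly r

  wasted-run : ∀ {x y d SA SB σ τ} {tA : PTree I O d} {tB : PTree J O d} →
    WF SA tA → Sender σ tA x → WF SB tB → Sender τ tB y →
    ∃₂ λ oA oB → Run x y tA tB oA oB false
  wasted-run {σ = σ} {τ} wA@(wf-node _ _ _ _ _ _ _ _ _ _ _) lx
                         wB@(wf-node _ _ _ _ _ _ _ _ _ _ _) ly =
    let oA , oB , _ , r = some-run (WF-sendChild σ wA) lx (WF-sendChild τ wB) ly
    in oA , oB , run-wasted σ τ lx ly r

  runs-from-leaf-agree : ∀ {x y y′ e oA oA′ oB oB′ c c′} {tA : PTree I O e} {tB tB′ : PTree J O e} →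
    e ≡ 0 → Run x y tA tB oA oB c → Run x y′ tA tB′ oA′ oB′ c′ → oA ≡ oA′
  runs-from-leaf-agree refl run-leaf run-leaf = refl

  both-send⇒wasted-run : ∀ {x y d SA SB} ρ {tA : PTree I O d} {tB : PTree J O d} →
    WF SA tA → WF SB tB → length ρ < d → Sends SA tA ρ x → Sends SB tB ρ y →
    ∃₂ λ oA oB → Run x y tA tB oA oB false
  both-send⇒wasted-run ρ wA wB ρ<d (cx , ¬rx) (cy , ¬ry)
    with receives-or-reaches-sender ρ wA cx ρ<d | receives-or-reaches-sender ρ wB cy ρ<d
  ... | inj₁ rx | _       = ⊥-elim (¬rx rx)
  ... | inj₂ _  | inj₁ ry = ⊥-elim (¬ry ry)
  ... | inj₂ (reached px _ wx , _ , lx) | inj₂ (reached py _ wy , _ , ly) =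
    let oA , oB , r = wasted-run wx lx wy ly
        b , r′ = run-along px py r
    in oA , oB , subst (Run _ _ _ _ oA oB) (∧-zeroʳ b) r′

  common-extension-or-both-send : ∀ {x y d SA SB} ρ {tA : PTree I O d} {tB : PTree J O d} →
    WF SA tA → SA x → WF SB tB → SB y → length ρ < d → Cons SA tA ρ x → Cons SB tB ρ y →
    (∃ λ b → Cons SA tA (ρ ++ [ b ]) x × Cons SB tB (ρ ++ [ b ]) y) ⊎
    Sends SA tA ρ x × Sends SB tB ρ y
  common-extension-or-both-send ρ wA sx wB sy ρ<d cx cy
    with Receives? wA sx ρ | Receives? wB sy ρ
  ... | yes rx | _      = let b , cy′ = Cons-extend ρ wB cy ρ<d in inj₁ (b , rx b , cy′)
  ... | no _   | yes ry = let b , cx′ = Cons-extend ρ wA cx ρ<d in inj₁ (b , cx′ , ry b)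
  ... | no ¬rx | no ¬ry = inj₂ ((cx , ¬rx) , (cy , ¬ry))

  full-runs-share-Alice-output : ∀ {x y y′ d SA SB} ρ {tA : PTree I O d} {tB : PTree J O d} →
    WF SA tA → WF SB tB → length ρ ≡ d → Cons SA tA ρ x → Cons SB tB ρ y → Cons SB tB ρ y′ →
    ∃ λ oA → (∃₂ λ oB c → Run x y tA tB oA oB c) × (∃₂ λ oB c → Run x y′ tA tB oA oB c)
  full-runs-share-Alice-output ρ wA wB refl cx cy cy′
    with reach ρ wA cx | reach ρ wB cy | reach ρ wB cy′
  ... | reached px sx wx | reached py sy wy | reached py′ sy′ wy′
    with some-run wx sx wy sy | some-run wx sx wy′ sy′
  ... | oA , oB , _ , r | oA′ , oB′ , _ , r′ with runs-from-leaf-agree (n∸n≡0 (length ρ)) r r′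
  ... | refl = oA , (oB , _ , proj₂ (run-along px py r)) , (oB′ , _ , proj₂ (run-along px py′ r′))

Colour : ℕ → Set
Colour zero    = Bool
Colour (suc k) = Bool × Colour k × Colour k

#Colour : ℕ → ℕ
#Colour zero    = 2
#Colour (suc k) = 2 * (#Colour k * #Colour k)

Colour↣Fin : ∀ k → Colour k ↣ Fin (#Colour k)
Colour↣Fin zero    = ↔⇒↣ (↔-sym 2↔Bool)
Colour↣Fin (suc k) =
  ↔⇒↣ (↔-sym *↔×) ↣-∘
  (Colour↣Fin zero ×-↣ (↔⇒↣ (↔-sym *↔×) ↣-∘ (Colour↣Fin k ×-↣ Colour↣Fin k)))

#Colour-bound : ∀ k → 2 * #Colour k ≤ 2 ^ 2 ^ suc k
#Colour-bound zero    = ≤-refl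
#Colour-bound (suc k) = begin
  2 * (2 * (c * c))               ≡⟨ *-assoc 2 2 (c * c) ⟨
  (2 * 2) * (c * c)               ≡⟨ [m*n]*[o*p]≡[m*o]*[n*p] 2 c 2 c ⟨
  (2 * c) * (2 * c)               ≤⟨ *-mono-≤ (#Colour-bound k) (#Colour-bound k) ⟩
  2 ^ 2 ^ suc k * 2 ^ 2 ^ suc k   ≡⟨ ^-distribˡ-+-* 2 (2 ^ suc k) (2 ^ suc k) ⟨
  2 ^ (2 ^ suc k + 2 ^ suc k)     ≡⟨ cong (λ s → 2 ^ (2 ^ suc k + s)) (+-identityʳ (2 ^ suc k)) ⟨
  2 ^ 2 ^ suc (suc k)             ∎
  where
  open ≤-Reasoning
  c : ℕ
  c = #Colour k

^-distribʳ-* : ∀ m n o → (m * n) ^ o ≡ m ^ o * n ^ o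
^-distribʳ-* m n zero    = refl
^-distribʳ-* m n (suc o) =
  trans (cong (m * n *_) (^-distribʳ-* m n o)) ([m*n]*[o*p]≡[m*o]*[n*p] m n (m ^ o) (n ^ o))

^-cancelˡ-< : ∀ o {m n} → m ^ o < n ^ o → m < n
^-cancelˡ-< o mᵒ<nᵒ = ≰⇒> λ n≤m → <⇒≱ mᵒ<nᵒ (^-monoˡ-≤ o n≤m)

^-cancelˡ-≤ : ∀ o .{{_ : NonZero o}} {m n} → m ^ o ≤ n ^ o → m ≤ n
^-cancelˡ-≤ o mᵒ≤nᵒ = ≮⇒≥ λ n<m → <⇒≱ (^-monoˡ-< o n<m) mᵒ≤nᵒ

2*a<3*b : ∀ a b → a ^ 8 < 2 * b ^ 8 → 2 * a < 3 * b
2*a<3*b a b a⁸<2b⁸ = ^-cancelˡ-< 8 (begin-strict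
  (2 * a) ^ 8        ≡⟨ ^-distribʳ-* 2 a 8 ⟩
  256 * a ^ 8        <⟨ *-monoʳ-< 256 a⁸<2b⁸ ⟩
  256 * (2 * b ^ 8)  ≡⟨ *-assoc 256 2 (b ^ 8) ⟨
  512 * b ^ 8        ≤⟨ *-monoˡ-≤ (b ^ 8) (m≤m+n 512 6049) ⟩
  6561 * b ^ 8       ≡⟨ ^-distribʳ-* 3 b 8 ⟨
  (3 * b) ^ 8        ∎)
  where open ≤-Reasoning

2^a≤3^b : ∀ a b → 2 * a ≤ 3 * b → 2 ^ a ≤ 3 ^ b
2^a≤3^b a b 2a≤3b = ^-cancelˡ-≤ 2 (begin
  (2 ^ a) ^ 2   ≡⟨ ^-*-assoc 2 a 2 ⟩
  2 ^ (a * 2)   ≡⟨ cong (2 ^_) (*-comm a 2) ⟩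
  2 ^ (2 * a)   ≤⟨ ^-monoʳ-≤ 2 2a≤3b ⟩
  2 ^ (3 * b)   ≡⟨ ^-*-assoc 2 3 b ⟨
  8 ^ b         ≤⟨ ^-monoˡ-≤ b (m≤m+n 8 1) ⟩
  9 ^ b         ≡⟨ ^-*-assoc 3 2 b ⟩
  3 ^ (2 * b)   ≡⟨ cong (3 ^_) (*-comm 2 b) ⟩
  3 ^ (b * 2)   ≡⟨ ^-*-assoc 3 b 2 ⟨
  (3 ^ b) ^ 2   ∎)
  where open ≤-Reasoning

-- With N = 2^(e+1+ℓ) the hypothesis of LogBound reads (a/b)^(8N) < χ^(2^ℓ) ≤ 2^N,
-- so a/b < 2^(1/8) < 3/2 < log₂ 3 ≤ log₂ χ.
LogBound-from-doubly-exponential : ∀ ℓ e {χ} → 3 ≤ χ → χ ≤ 2 ^ 2 ^ suc e → LogBound (ℓ + e) ℓ χ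
LogBound-from-doubly-exponential ℓ e {χ} 3≤χ χ≤ a b _ hyp = begin
  2 ^ a   ≤⟨ 2^a≤3^b a b (<⇒≤ (2*a<3*b a b (^-cancelˡ-< N a⁸ᴺ<[2b⁸]ᴺ))) ⟩
  3 ^ b   ≤⟨ ^-monoˡ-≤ b 3≤χ ⟩
  χ ^ b   ∎
  where
  open ≤-Reasoning
  N Q : ℕ
  N = 2 ^ (suc e + ℓ)
  Q = 2 ^ (ℓ + e + 4)

  Q≡8N : Q ≡ 8 * N
  Q≡8N = trans (cong (2 ^_) (trans (+-comm (ℓ + e) 4) (cong (4 +_) (+-comm ℓ e))))
               (^-distribˡ-+-* 2 3 (suc e + ℓ))

  χ^2^ℓ≤2^N : χ ^ 2 ^ ℓ ≤ 2 ^ N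
  χ^2^ℓ≤2^N = begin
    χ ^ 2 ^ ℓ                  ≤⟨ ^-monoˡ-≤ (2 ^ ℓ) χ≤ ⟩
    (2 ^ 2 ^ suc e) ^ 2 ^ ℓ    ≡⟨ ^-*-assoc 2 (2 ^ suc e) (2 ^ ℓ) ⟩
    2 ^ (2 ^ suc e * 2 ^ ℓ)    ≡⟨ cong (2 ^_) (^-distribˡ-+-* 2 (suc e) ℓ) ⟨
    2 ^ N                      ∎

  a⁸ᴺ<[2b⁸]ᴺ : (a ^ 8) ^ N < (2 * b ^ 8) ^ N
  a⁸ᴺ<[2b⁸]ᴺ = begin-strict
    (a ^ 8) ^ N             ≡⟨ trans (^-*-assoc a 8 N) (cong (a ^_) (sym Q≡8N)) ⟩
    a ^ Q                   <⟨ hyp ⟩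
    χ ^ 2 ^ ℓ * b ^ Q       ≤⟨ *-monoˡ-≤ (b ^ Q) χ^2^ℓ≤2^N ⟩
    2 ^ N * b ^ Q           ≡⟨ cong (2 ^ N *_) (trans (cong (b ^_) Q≡8N) (sym (^-*-assoc b 8 N))) ⟩
    2 ^ N * (b ^ 8) ^ N     ≡⟨ ^-distribʳ-* 2 (b ^ 8) N ⟨
    (2 * b ^ 8) ^ N         ∎

+-suc≡⇒< : ∀ {l k d} → l + suc k ≡ d → l < d
+-suc≡⇒< {l} l+k+1≡d = <-≤-trans (m<m+n l z<s) (≤-reflexive l+k+1≡d)

length-snoc-+ : ∀ {A : Set} (ρ : List A) b {k d} →
                length ρ + suc k ≡ d → length (ρ ++ [ b ]) + k ≡ d
length-snoc-+ ρ _ {k} ρ+k+1≡d =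
  trans (cong (_+ k) (length-++ ρ)) (trans (+-assoc (length ρ) 1 k) ρ+k+1≡d)

module Colouring {m n} {f : Vec Bool m → Bool} (Π : KWMux.Protocol m n f) where
  open KWMux m n f

  BobReaches : Fn → List Bool → Set
  BobReaches g ρ = ∃ (Yπ Π ρ g)

  AliceSends : Fn → List Bool → Set
  AliceSends g ρ = ∃ λ X → Σ (f (app g X) ≡ true) λ p → Sends (λ _ → ⊤) (ΠA Π) ρ (g , X , p)

  Mat-searchable : Searchable Mat
  Mat-searchable = Vec-searchable (Vec-searchable Bool-searchable n) m

  BobReaches? : ∀ g ρ → Dec (BobReaches g ρ)
  BobReaches? g ρ = Mat-searchable λ Y → Σ-≡? (f (app g Y)) false λ _ → Cons? (wfB Π) tt ρ

  AliceSends? : ∀ g ρ → Dec (AliceSends g ρ)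
  AliceSends? g ρ = Mat-searchable λ X → Σ-≡? (f (app g X)) true λ _ → Sends? (wfA Π) tt ρ

  colour : Fn → (k : ℕ) → List Bool → Colour k
  colour g zero    ρ = isYes (BobReaches? g ρ)
  colour g (suc k) ρ = isYes (AliceSends? g ρ) , colour g k (ρ ++ [ false ]) , colour g k (ρ ++ [ true ])

  colour-children : ∀ {g₁ g₂} k ρ → colour g₁ (suc k) ρ ≡ colour g₂ (suc k) ρ →
                    ∀ b → colour g₁ k (ρ ++ [ b ]) ≡ colour g₂ k (ρ ++ [ b ])
  colour-children _ _ same false = cong (proj₁ ∘ proj₂) same
  colour-children _ _ same true  = cong (proj₂ ∘ proj₂) same

  AgreeWhereDiffer : Fn → Fn → Mat → Mat → Set
  AgreeWhereDiffer g₁ g₂ X Y =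
    ∀ i → lookup (app g₁ X) i ≢ lookup (app g₂ Y) i → lookup X i ≡ lookup Y i

  no-output-valid-against-both : ∀ {g₁ g₂ X Y Y′ pX pY pY′} o → AgreeWhereDiffer g₁ g₂ X Y →
    Valid (g₁ , X , pX) (g₂ , Y , pY) o → Valid (g₁ , X , pX) (g₁ , Y′ , pY′) o → ⊥
  no-output-valid-against-both (just (i , j)) agree (aᵢ≢bᵢ , Xᵢⱼ≢Yᵢⱼ) _ =
    Xᵢⱼ≢Yᵢⱼ (cong (λ row → lookup row j) (agree i aᵢ≢bᵢ))
  no-output-valid-against-both nothing _ _ g₁≠g₁ = g₁≠g₁ λ _ → refl

  module _ (phd : PartiallyHalfDuplex Π) (sol : Solves Π) where

    WeakInt⇒colour≢ : ∀ {g₁ g₂} k ρ → length ρ + k ≡ depth Π →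
                      WeakInt Π ρ g₁ g₂ → colour g₁ k ρ ≢ colour g₂ k ρ
    WeakInt⇒colour≢ {g₁} {g₂} zero ρ ρ+0≡D (X , Y , (pX , cX) , (pY , cY) , agree) same
      with isYes-transfer (BobReaches? g₂ ρ) (BobReaches? g₁ ρ) (sym same) (Y , pY , cY)
    ... | Y′ , pY′ , cY′
      with full-runs-share-Alice-output ρ (wfA Π) (wfB Π) (trans (sym (+-identityʳ _)) ρ+0≡D) cX cY cY′
    ... | o , (_ , _ , r) , (_ , _ , r′) =
      no-output-valid-against-both o agree (proj₂ (sol _ _ _ _ _ r)) (proj₂ (sol _ _ _ _ _ r′))
    WeakInt⇒colour≢ {g₁} {g₂} (suc k) ρ ρ+k+1≡D (X , Y , (pX , cX) , (pY , cY) , agree) same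
      with common-extension-or-both-send ρ (wfA Π) tt (wfB Π) tt (+-suc≡⇒< ρ+k+1≡D) cX cY
    ... | inj₁ (b , cX′ , cY′) =
      WeakInt⇒colour≢ k (ρ ++ [ b ]) (length-snoc-+ ρ b ρ+k+1≡D)
        (X , Y , (pX , cX′) , (pY , cY′) , agree) (colour-children k ρ same b)
    ... | inj₂ (sX , sY)
      with isYes-transfer (AliceSends? g₁ ρ) (AliceSends? g₂ ρ) (cong proj₁ same) (X , pX , sX)
    ... | X₀ , pX₀ , sX₀ with both-send⇒wasted-run ρ (wfA Π) (wfB Π) (+-suc≡⇒< ρ+k+1≡D) sX₀ sY
    ... | _ , _ , r with phd (g₂ , X₀ , pX₀) (g₂ , Y , pY) (λ _ → refl) _ _ _ r
    ... | ()

    colourable : ∀ π e → length π + e ≡ depth Π → Colorable (𝒱π Π π) (Adjπ Π π) (#Colour e)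
    colourable π e π+e≡D = (λ g _ → to (colour g e π)) , proper
      where
      open Injection (Colour↣Fin e) using (to; injective)
      proper : ∀ g₁ g₂ (_ : 𝒱π Π π g₁) (_ : 𝒱π Π π g₂) →
               Adjπ Π π g₁ g₂ → to (colour g₁ e π) ≢ to (colour g₂ e π)
      proper _ _ _ _ (_ , inj₁ wi) same = WeakInt⇒colour≢ e π π+e≡D wi (injective same)
      proper _ _ _ _ (_ , inj₂ wi) same = WeakInt⇒colour≢ e π π+e≡D wi (sym (injective same))

lemma4p4 : (m n : ℕ) (f : Vec Bool m → Bool) (Π : KWMux.Protocol m n f) →
    KWMux.PartiallyHalfDuplex m n f Π → KWMux.Solves m n f Π →
    (π₁ : List Bool) → KWMux.IsTranscript m n f Π π₁ →
    ∃ (KWMux.𝒱π m n f Π π₁) →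
    (χ : ℕ) → IsChromaticNumber (KWMux.𝒱π m n f Π π₁) (KWMux.Adjπ m n f Π π₁) χ →
    3 ≤ χ →
    LogBound (KWMux.Protocol.depth Π) (length π₁) χ
lemma4p4 m n f Π phd sol π₁ ((_ , cx) , _) _ χ (_ , minimal) 3≤χ =
  subst (λ D → LogBound D ℓ χ) ℓ+e≡D (LogBound-from-doubly-exponential ℓ e 3≤χ χ≤2^2^[e+1])
  where
  open KWMux.Protocol Π using (depth; wfA)
  ℓ e : ℕ
  ℓ = length π₁
  e = depth ∸ ℓ

  ℓ+e≡D : ℓ + e ≡ depth
  ℓ+e≡D = m+[n∸m]≡n (Path⇒length≤ (Reached.path (reach π₁ wfA cx)))

  χ≤2^2^[e+1] : χ ≤ 2 ^ 2 ^ suc e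
  χ≤2^2^[e+1] = begin
    χ             ≤⟨ minimal (#Colour e) (Colouring.colourable Π phd sol π₁ e ℓ+e≡D) ⟩
    #Colour e     ≤⟨ m≤n*m (#Colour e) 2 ⟩
    2 * #Colour e ≤⟨ #Colour-bound e ⟩
    2 ^ 2 ^ suc e ∎
    where open ≤-Reasoning
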